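{- Let $T$ be a tip-augmented plane tree with $n\geq 2$ edges and root $r$. For a tip-augmented plane tree $S$ write $\mathrm{sg}(S)$ for its number of singleton leaves and $\mathrm{en}(S)$ for its number of elder non-twin leaves, with $\mathrm{sg}(S)=\mathrm{en}(S)=0$ when $S$ is a single vertex. \begin{itemize} \item If $T$ is in class A1 with subtrees $T_1,\dots,T_k$, then $\mathrm{sg}(T)=\sum_i \mathrm{sg}(T_i)$ and $\mathrm{en}(T)=\sum_i \mathrm{en}(T_i)$. \item If $T$ is in class A2 with subtrees $T_1,\dots,T_k$, then $\mathrm{sg}(T)=1+\sum_i \mathrm{sg}(T_i)$ and $\mathrm{en}(T)=1+\sum_i \mathrm{en}(T_i)$. \item If $T$ is in class B1 with tree $A$ and subtrees $T_1,\dots,T_k$, then $\mathrm{sg}(T)=\mathrm{sg}(A)+\sum_i \mathrm{sg}(T_i)$ and $\mathrm{en}(T)=1+\mathrm{en}(A)+\sum_i \mathrm{en}(T_i)$. \item If $T$ is in class B2 with tree $B$ and subtrees $T'_1,\dots,T'_k$, then $\mathrm{sg}(T)=1+\mathrm{sg}(B)+\sum_i \mathrm{sg}(T'_i)$ and $\mathrm{en}(T)=\mathrm{en}(B)+\sum_i \mathrm{en}(T'_i)$. \end{itemize}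
   Context: A plane tree is a rooted tree in which the children of each vertex are linearly ordered (left to right). A leaf is a non-root vertex with no children; an interior vertex is a vertex with at least one child. A tip-augmented plane tree is a plane tree in which the leftmost child of every interior vertex is a leaf. Leaves are classified: a singleton leaf is a leaf with no siblings; an elder twin leaf is a leaf that is the leftmost child of its parent and the second child of that parent is also a leaf; an elder non-twin leaf is a leaf that is the leftmost child of its parent and the second child of that parent is not a leaf; a second leaf is a leaf that is the second child of its parent; a younger leaf is a leaf that is neither the first nor the second child of its parent. A vertex is "a parent of a singleton leaf" if it has exactly one child and that child is a leaf. Let $T$ be a tip-augmented plane tree with $n\ge 2$ edges and root $r$; then $r$ has at least two children. The four classes are: A1: the second child of $r$ is a leaf, and no child of $r$ is a parent of a singleton leaf. A2: the second child $u$ of $r$ is a parent of a singleton leaf $v$, and no other child of $r$ is a parent of a singleton leaf. B1: the second child $u$ of $r$ is the root of a subtree $A$ (consisting of $u$ and all its descendants) with at least two edges, and no child of $r$ is a parent of a singleton leaf. B2: $T$ is not in A2 and at least one child of $r$ is a parent of a singleton leaf. In classes A1, A2, B1, if $r$ has $k+2$ children, $T_1,\dots,T_k$ denote the subtrees rooted at the 3rd, ..., $(k+2)$-th children of $r$ (each is a single vertex or a tip-augmented plane tree with at least two edges). In class B2, let $u$ be the rightmost child of $r$ that is a parent of a singleton leaf; $B$ denotes the tree rooted at $r$ consisting of $r$ together with all children of $r$ to the left of $u$ and their descendants (in the same order), and $T'_1,\dots,T'_k$ denote the subtrees rooted at the children of $r$ to the right of $u$, in order. -}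

module Defs where

open import Data.Nat using (ℕ; zero; suc; _+_; _≤_)
open import Data.List using (List; []; _∷_; length)
open import Data.List.Relation.Unary.All using (All)
open import Data.List.Relation.Unary.Any using (Any)
open import Data.Product using (_×_)
open import Data.Empty using (⊥)
open import Relation.Nullary using (¬_)
open import Relation.Binary.PropositionalEquality using (_≡_)

-- A plane tree: a vertex together with the ordered (left to right) list of
-- the subtrees rooted at its children.
data Tree : Set where
  node : List Tree → Tree

children : Tree → List Tree
children (node cs) = cs

leaf : Tree
leaf = node []

-- a (non-root) child vertex is a leaf iff its subtree is a single vertex
IsLeaf : Tree → Set
IsLeaf t = t ≡ leaf

-- a (child) vertex is a parent of a singleton leaf iff it has exactly one
-- child and that child is a leaf
IsPSL : Tree → Set
IsPSL t = t ≡ node (leaf ∷ [])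

mutual
  edges : Tree → ℕ
  edges (node cs) = length cs + edgesL cs

  edgesL : List Tree → ℕ
  edgesL [] = 0
  edgesL (c ∷ cs) = edges c + edgesL cs

data TipAug : Tree → Set where
  tip-single : TipAug (node [])
  tip-int    : (cs : List Tree) → All TipAug (leaf ∷ cs) → TipAug (node (leaf ∷ cs))

sgHere : List Tree → ℕ
sgHere (node [] ∷ []) = 1
sgHere _ = 0

-- number of elder non-twin leaves among the children of a vertex with child
-- list cs: 1 iff the leftmost child is a leaf and the second child exists
-- and is not a leaf
enHere : List Tree → ℕ
enHere (node [] ∷ node (_ ∷ _) ∷ _) = 1
enHere _ = 0

mutual
  sg : Tree → ℕ
  sg (node cs) = sgHere cs + sgL cs

  sgL : List Tree → ℕ
  sgL [] = 0
  sgL (c ∷ cs) = sg c + sgL cs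

mutual
  en : Tree → ℕ
  en (node cs) = enHere cs + enL cs

  enL : List Tree → ℕ
  enL [] = 0
  enL (c ∷ cs) = en c + enL cs

InA1 : Tree → Set
InA1 (node (c1 ∷ c2 ∷ ts)) = IsLeaf c2 × All (λ c → ¬ IsPSL c) (c1 ∷ c2 ∷ ts)
InA1 _ = ⊥

InA2 : Tree → Set
InA2 (node (c1 ∷ c2 ∷ ts)) = IsPSL c2 × All (λ c → ¬ IsPSL c) (c1 ∷ ts)
InA2 _ = ⊥

InB1 : Tree → Set
InB1 (node (c1 ∷ c2 ∷ ts)) = 2 ≤ edges c2 × All (λ c → ¬ IsPSL c) (c1 ∷ c2 ∷ ts)
InB1 _ = ⊥

InB2 : Tree → Set
InB2 t = (¬ InA2 t) × Any IsPSL (children t)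

{-# OPTIONS --safe #-}
module Submission where

-- Once the root has at least two children, its own contributions sgHere and
-- enHere depend only on its first two children, so sg and en are additive
-- over any cut of the child list after the second child.  In classes A1, A2
-- and B1 cut right after the second child c2; the left part then contributes
-- what c2 alone dictates.  In class B2 cut right before u: the prefix B has
-- at least two children, since u is not a leaf (so not the first child) and
-- u being the second child would put the tree in A2.

open import Defs
open import Data.Nat using (ℕ; suc; _+_; _≤_)
open import Data.Nat.Properties using (+-assoc; +-suc; +-identityʳ)
open import Data.Nat.ListAction using (sum)
open import Data.Nat.ListAction.Properties using (sum-++)
open import Data.List using (List; []; _∷_; _++_; map)
open import Data.List.Properties using (map-++)
open import Data.List.Relation.Unary.All using (All; _∷_)
open import Data.Product using (_×_; _,_)
open import Data.Empty using (⊥-elim)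
open import Relation.Nullary using (¬_)
open import Relation.Binary.PropositionalEquality
  using (_≡_; refl; sym; trans; cong; module ≡-Reasoning)
open ≡-Reasoning

sgL≡sum∘map : ∀ cs → sgL cs ≡ sum (map sg cs)
sgL≡sum∘map []       = refl
sgL≡sum∘map (c ∷ cs) = cong (sg c +_) (sgL≡sum∘map cs)

enL≡sum∘map : ∀ cs → enL cs ≡ sum (map en cs)
enL≡sum∘map []       = refl
enL≡sum∘map (c ∷ cs) = cong (en c +_) (enL≡sum∘map cs)

sumMap-++ : (f : Tree → ℕ) (cs ds : List Tree) →
            sum (map f (cs ++ ds)) ≡ sum (map f cs) + sum (map f ds)
sumMap-++ f cs ds = trans (cong sum (map-++ f cs ds)) (sum-++ (map f cs) (map f ds))

enHere-++ : ∀ x y zs ms → enHere (x ∷ y ∷ zs ++ ms) ≡ enHere (x ∷ y ∷ zs)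
enHere-++ (node [])      (node [])      zs ms = refl
enHere-++ (node [])      (node (_ ∷ _)) zs ms = refl
enHere-++ (node (_ ∷ _)) y              zs ms = refl

sgHere-∷∷ : ∀ x y zs → sgHere (x ∷ y ∷ zs) ≡ 0
sgHere-∷∷ (node [])      y zs = refl
sgHere-∷∷ (node (_ ∷ _)) y zs = refl

sg-node-∷∷ : ∀ x y zs → sg (node (x ∷ y ∷ zs)) ≡ sum (map sg (x ∷ y ∷ zs))
sg-node-∷∷ x y zs = begin
  sgHere (x ∷ y ∷ zs) + sgL (x ∷ y ∷ zs)  ≡⟨ cong (_+ sgL (x ∷ y ∷ zs)) (sgHere-∷∷ x y zs) ⟩
  sgL (x ∷ y ∷ zs)                        ≡⟨ sgL≡sum∘map (x ∷ y ∷ zs) ⟩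
  sum (map sg (x ∷ y ∷ zs))               ∎

sg-node-++ : ∀ x y zs ms →
             sg (node (x ∷ y ∷ zs ++ ms)) ≡ sg (node (x ∷ y ∷ zs)) + sum (map sg ms)
sg-node-++ x y zs ms = begin
  sg (node (x ∷ y ∷ zs ++ ms))                    ≡⟨ sg-node-∷∷ x y (zs ++ ms) ⟩
  sum (map sg (x ∷ y ∷ zs ++ ms))                 ≡⟨ sumMap-++ sg (x ∷ y ∷ zs) ms ⟩
  sum (map sg (x ∷ y ∷ zs)) + sum (map sg ms)     ≡⟨ cong (_+ sum (map sg ms)) (sym (sg-node-∷∷ x y zs)) ⟩
  sg (node (x ∷ y ∷ zs)) + sum (map sg ms)        ∎

en-node-++ : ∀ x y zs ms →
             en (node (x ∷ y ∷ zs ++ ms)) ≡ en (node (x ∷ y ∷ zs)) + sum (map en ms)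
en-node-++ x y zs ms = begin
  enHere (x ∷ y ∷ zs ++ ms) + enL (x ∷ y ∷ zs ++ ms)
    ≡⟨ cong (_+ enL (x ∷ y ∷ zs ++ ms)) (enHere-++ x y zs ms) ⟩
  here + enL (x ∷ y ∷ zs ++ ms)
    ≡⟨ cong (here +_) (enL≡sum∘map (x ∷ y ∷ zs ++ ms)) ⟩
  here + sum (map en (x ∷ y ∷ zs ++ ms))
    ≡⟨ cong (here +_) (sumMap-++ en (x ∷ y ∷ zs) ms) ⟩
  here + (sum (map en (x ∷ y ∷ zs)) + sum (map en ms))
    ≡⟨ cong (λ s → here + (s + sum (map en ms))) (sym (enL≡sum∘map (x ∷ y ∷ zs))) ⟩
  here + (enL (x ∷ y ∷ zs) + sum (map en ms))
    ≡⟨ sym (+-assoc here (enL (x ∷ y ∷ zs)) (sum (map en ms))) ⟩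
  en (node (x ∷ y ∷ zs)) + sum (map en ms) ∎
  where here = enHere (x ∷ y ∷ zs)

classA1 : (c1 c2 : Tree) (ts : List Tree) →
  TipAug (node (c1 ∷ c2 ∷ ts)) → 2 ≤ edges (node (c1 ∷ c2 ∷ ts)) →
  InA1 (node (c1 ∷ c2 ∷ ts)) →
  (sg (node (c1 ∷ c2 ∷ ts)) ≡ sum (map sg ts))
    × (en (node (c1 ∷ c2 ∷ ts)) ≡ sum (map en ts))
classA1 _ _ ts (tip-int _ _) _ (refl , _) =
  sg-node-++ leaf leaf [] ts , en-node-++ leaf leaf [] ts

classA2 : (c1 c2 : Tree) (ts : List Tree) →
  TipAug (node (c1 ∷ c2 ∷ ts)) → 2 ≤ edges (node (c1 ∷ c2 ∷ ts)) →
  InA2 (node (c1 ∷ c2 ∷ ts)) →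
  (sg (node (c1 ∷ c2 ∷ ts)) ≡ 1 + sum (map sg ts))
    × (en (node (c1 ∷ c2 ∷ ts)) ≡ 1 + sum (map en ts))
classA2 _ _ ts (tip-int _ _) _ (refl , _) =
  sg-node-++ leaf (node (leaf ∷ [])) [] ts , en-node-++ leaf (node (leaf ∷ [])) [] ts

classB1 : (c1 A : Tree) (ts : List Tree) →
  TipAug (node (c1 ∷ A ∷ ts)) → 2 ≤ edges (node (c1 ∷ A ∷ ts)) →
  InB1 (node (c1 ∷ A ∷ ts)) →
  (sg (node (c1 ∷ A ∷ ts)) ≡ sg A + sum (map sg ts))
    × (en (node (c1 ∷ A ∷ ts)) ≡ 1 + en A + sum (map en ts))
classB1 _     (node [])        ts _             _ (() , _)
classB1 _     A@(node (_ ∷ _)) ts (tip-int _ _) _ _ =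
  trans (sg-node-++ leaf A [] ts) (cong (_+ sum (map sg ts)) (+-identityʳ (sg A))) ,
  trans (en-node-++ leaf A [] ts) (cong (λ e → suc e + sum (map en ts)) (+-identityʳ (en A)))

classB2 : (ls : List Tree) (u : Tree) (rs : List Tree) →
  TipAug (node (ls ++ u ∷ rs)) → 2 ≤ edges (node (ls ++ u ∷ rs)) →
  InB2 (node (ls ++ u ∷ rs)) →
  IsPSL u → All (λ c → ¬ IsPSL c) rs →
  (sg (node (ls ++ u ∷ rs)) ≡ 1 + sg (node ls) + sum (map sg rs))
    × (en (node (ls ++ u ∷ rs)) ≡ en (node ls) + sum (map en rs))
classB2 []           _ rs ()            _ _          refl _
classB2 (_ ∷ [])     _ rs (tip-int _ _) _ (¬A2 , _) refl ¬psl-rs =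
  ⊥-elim (¬A2 (refl , (λ ()) ∷ ¬psl-rs))
classB2 (x ∷ y ∷ zs) u rs _             _ _          refl _ =
  trans (sg-node-++ x y zs (u ∷ rs)) (+-suc (sg (node (x ∷ y ∷ zs))) (sum (map sg rs))) ,
  en-node-++ x y zs (u ∷ rs)

proposition2p1 :
    ((c1 c2 : Tree) (ts : List Tree) →
      TipAug (node (c1 ∷ c2 ∷ ts)) → 2 ≤ edges (node (c1 ∷ c2 ∷ ts)) →
      InA1 (node (c1 ∷ c2 ∷ ts)) →
      (sg (node (c1 ∷ c2 ∷ ts)) ≡ sum (map sg ts))
        × (en (node (c1 ∷ c2 ∷ ts)) ≡ sum (map en ts)))
    × ((c1 c2 : Tree) (ts : List Tree) →
      TipAug (node (c1 ∷ c2 ∷ ts)) → 2 ≤ edges (node (c1 ∷ c2 ∷ ts)) →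
      InA2 (node (c1 ∷ c2 ∷ ts)) →
      (sg (node (c1 ∷ c2 ∷ ts)) ≡ 1 + sum (map sg ts))
        × (en (node (c1 ∷ c2 ∷ ts)) ≡ 1 + sum (map en ts)))
    × ((c1 A : Tree) (ts : List Tree) →
      TipAug (node (c1 ∷ A ∷ ts)) → 2 ≤ edges (node (c1 ∷ A ∷ ts)) →
      InB1 (node (c1 ∷ A ∷ ts)) →
      (sg (node (c1 ∷ A ∷ ts)) ≡ sg A + sum (map sg ts))
        × (en (node (c1 ∷ A ∷ ts)) ≡ 1 + en A + sum (map en ts)))
    × ((ls : List Tree) (u : Tree) (rs : List Tree) →
      TipAug (node (ls ++ u ∷ rs)) → 2 ≤ edges (node (ls ++ u ∷ rs)) →
      InB2 (node (ls ++ u ∷ rs)) →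
      IsPSL u → All (λ c → ¬ IsPSL c) rs →
      (sg (node (ls ++ u ∷ rs)) ≡ 1 + sg (node ls) + sum (map sg rs))
        × (en (node (ls ++ u ∷ rs)) ≡ en (node ls) + sum (map en rs)))
proposition2p1 = classA1 , classA2 , classB1 , classB2
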